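{- For every involution $\pi\in\mathscr{I}_n$, the length $L(\pi)$ of $\pi$ equals the length $L(\mathcal{M}_\pi)$ of its matching $\mathcal{M}_\pi$.
   Context: $\mathscr{I}_n$ is the set of involutions in $S_n$. For $\pi\in\mathscr{I}_n$ with $k$ two-cycles, $L(\pi)=(\ell(\pi)+k)/2$ where $\ell$ is the Coxeter length (number of inversions). The matching $\mathcal{M}_\pi$ on vertices $1,\dots,n$ has isolated vertices the fixed points of $\pi$ and a strand $\{i<j\}$ for each two-cycle $(i,j)$ of $\pi$. Two strands $\{i<j\},\{k<l\}$ cross if $i<k<j<l$ or $k<i<l<j$. The length of a strand $\{i<j\}$ is $j-i$, and the length $L(\mathcal{M})$ of a matching is the sum of the lengths of its strands minus the number of crossing pairs of strands. -}

module Defs where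

open import Data.Nat using (ℕ; zero; suc; _+_; _*_; _∸_; _<_; _<?_; _/_)
open import Data.Fin using (Fin; toℕ)
open import Data.Nat.ListAction using (sum)
open import Data.List using (List; []; _∷_; map; length; filter; allFin; cartesianProduct)
open import Data.Product using (_×_; _,_; proj₁; proj₂)
open import Data.Sum using (_⊎_)
open import Data.Integer using (ℤ; +_; _-_)
open import Relation.Nullary using (Dec)
open import Relation.Nullary.Decidable using (_×-dec_; _⊎-dec_)
open import Relation.Binary.PropositionalEquality using (_≡_)

-- Permutations of {0,…,n-1} are functions Fin n → Fin n; an involution is
-- such a function with π (π i) ≡ i for all i (this forces bijectivity).
IsInvolution : {n : ℕ} → (Fin n → Fin n) → Set
IsInvolution π = ∀ i → π (π i) ≡ i

inversions : {n : ℕ} → (Fin n → Fin n) → ℕ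
inversions {n} π =
  length (filter (λ p → (toℕ (proj₁ p) <? toℕ (proj₂ p)) ×-dec (toℕ (π (proj₂ p)) <? toℕ (π (proj₁ p))))
                 (cartesianProduct (allFin n) (allFin n)))

-- Number of two-cycles of π: the points i with i < π i (each 2-cycle (i,j), i<j, counted once).
twoCycles : {n : ℕ} → (Fin n → Fin n) → ℕ
twoCycles {n} π = length (filter (λ i → toℕ i <? toℕ (π i)) (allFin n))

Linv : {n : ℕ} → (Fin n → Fin n) → ℕ
Linv π = (inversions π + twoCycles π) / 2

-- Matchings on vertices 1..n, given by their list of strands (i , j) with i < j
-- (vertices as natural numbers; isolated vertices are those not in any strand).
Strand : Set
Strand = ℕ × ℕ

Matching : Set
Matching = List Strand

matchingOf : {n : ℕ} → (Fin n → Fin n) → Matching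
matchingOf {n} π =
  map (λ i → (toℕ i , toℕ (π i))) (filter (λ i → toℕ i <? toℕ (π i)) (allFin n))

strandLength : Strand → ℕ
strandLength (i , j) = j ∸ i

Cross : Strand → Strand → Set
Cross (i , j) (k , l) = (i < k × k < j × j < l) ⊎ (k < i × i < l × l < j)

cross? : (s t : Strand) → Dec (Cross s t)
cross? (i , j) (k , l) =
  ((i <? k) ×-dec ((k <? j) ×-dec (j <? l))) ⊎-dec ((k <? i) ×-dec ((i <? l) ×-dec (l <? j)))

crossings : Matching → ℕ
crossings [] = 0
crossings (s ∷ ss) = length (filter (cross? s) ss) + crossings ss

Lmatch : Matching → ℤ
Lmatch M = + sum (map strandLength M) - + crossings M

-- Write x, π x, y, π y for a pair of points.  Then ℓ(π) + k + 2·cr(M_π) and twice the total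
-- strand length of M_π are both double sums over all (x, y) of weights that depend only on the
-- relative order of x, π x, y, π y (lhs and rhs below).  The weights differ pointwise, but the
-- double sums are unchanged by x ↔ π x, by y ↔ π y and by (x, π x) ↔ (y, π y); after averaging
-- over the eight symmetries so generated, the weights agree on every quadruple that can come from
-- an involution.  As only the order type matters, replacing each entry by its rank reduces this
-- to quadruples with entries below 4, which are checked by evaluation.  Halving gives the theorem.

module Submission where

open import Defs
open import Data.Bool using (Bool; true; false; not; _∧_; _∨_)
import Data.Bool.Properties as Bool
open import Data.Fin using (Fin; toℕ) renaming (zero to fzero; suc to fsuc)
open import Data.Fin.Patterns using (0F; 1F; 2F; 3F)
open import Data.Fin.Properties using (toℕ<n; toℕ-injective)
open import Data.Fin.Permutation using (permutation)
open import Data.List using (List; []; _∷_; map; length; filter; allFin; cartesianProduct; tabulate; _++_)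
open import Data.List.Properties using (map-∘; map-++; map-cong)
open import Data.Nat using (ℕ; zero; suc; _+_; _*_; _∸_; _/_; _<_; _≤_; _<?_; _<ᵇ_; z≤n; s≤s)
open import Data.Integer as ℤ using (+_)
import Data.Integer.Properties as ℤ
open import Data.Nat.DivMod using (m*n/n≡m)
open import Data.Nat.ListAction using (sum)
open import Data.Nat.ListAction.Properties using (sum-++)
open import Data.Nat.Properties
open import Data.Product using (_×_; _,_)
open import Data.Vec using (Vec; lookup) renaming ([] to []ᵛ; _∷_ to _∷ᵛ_; map to mapᵛ; tabulate to tabulateᵛ)
open import Data.Vec.Properties using (lookup-map; lookup∘tabulate; tabulate-cong)
open import Data.Vec.Membership.Propositional using (_∈_)
open import Data.Vec.Membership.Propositional.Properties using (∈-lookup)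
open import Data.Vec.Relation.Unary.Any using (here; there)
open import Function using (_∘_)
open import Relation.Nullary using (does; yes; no; contradiction)
open import Relation.Nullary.Decidable using (_×-dec_; _→-dec_; from-yes)
open import Relation.Unary using (Pred; Decidable)
open import Relation.Binary.PropositionalEquality
open import Relation.Binary.Definitions using (tri<; tri≈; tri>)

open import Algebra.Properties.Semiring.Sum +-*-semiring
  using (sum-syntax; sum-cong-≗; ∑-distrib-+; ∑-comm; ∑-permute; *-distribˡ-sum; sum-replicate-zero)

𝟙 : Bool → ℕ
𝟙 true  = 1
𝟙 false = 0

module _ {a p} {A : Set a} {P : Pred A p} (P? : Decidable P) where

  length-filter≡sum : (xs : List A) → length (filter P? xs) ≡ sum (map (𝟙 ∘ does ∘ P?) xs)
  length-filter≡sum [] = refl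
  length-filter≡sum (x ∷ xs) with does (P? x)
  ... | true  = cong suc (length-filter≡sum xs)
  ... | false = length-filter≡sum xs

  sum-map-filter : (f : A → ℕ) (xs : List A) →
                   sum (map f (filter P? xs)) ≡ sum (map (λ x → 𝟙 (does (P? x)) * f x) xs)
  sum-map-filter f [] = refl
  sum-map-filter f (x ∷ xs) with does (P? x)
  ... | true  = cong₂ _+_ (sym (*-identityˡ (f x))) (sum-map-filter f xs)
  ... | false = sum-map-filter f xs

sum-map-tabulate : ∀ {a} {A : Set a} {n} (f : A → ℕ) (g : Fin n → A) →
                   sum (map f (tabulate g)) ≡ ∑[ i < n ] f (g i)
sum-map-tabulate {n = zero}  f g = refl
sum-map-tabulate {n = suc n} f g = cong (_+_ (f (g fzero))) (sum-map-tabulate f (g ∘ fsuc))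

sum-map-allFin : ∀ {n} (f : Fin n → ℕ) → sum (map f (allFin n)) ≡ ∑[ i < n ] f i
sum-map-allFin f = sum-map-tabulate f (λ i → i)

sum-map-cartesianProduct : ∀ {a b} {A : Set a} {B : Set b} (f : A × B → ℕ) xs ys →
  sum (map f (cartesianProduct xs ys)) ≡ sum (map (λ x → sum (map (λ y → f (x , y)) ys)) xs)
sum-map-cartesianProduct f [] ys = refl
sum-map-cartesianProduct f (x ∷ xs) ys = begin
  sum (map f (map (x ,_) ys ++ cartesianProduct xs ys))
    ≡⟨ cong sum (map-++ f (map (x ,_) ys) _) ⟩
  sum (map f (map (x ,_) ys) ++ map f (cartesianProduct xs ys))
    ≡⟨ sum-++ (map f (map (x ,_) ys)) _ ⟩
  sum (map f (map (x ,_) ys)) + sum (map f (cartesianProduct xs ys))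
    ≡⟨ cong₂ _+_ (cong sum (sym (map-∘ ys))) (sum-map-cartesianProduct f xs ys) ⟩
  sum (map (λ y → f (x , y)) ys) + sum (map (λ x → sum (map (λ y → f (x , y)) ys)) xs) ∎
  where open ≡-Reasoning

pairwiseSum : ∀ {a} {A : Set a} → List A → (A → A → ℕ) → ℕ
pairwiseSum []       h = 0
pairwiseSum (x ∷ xs) h = sum (map (h x) xs) + pairwiseSum xs h

crossings≡pairwiseSum : ∀ M → crossings M ≡ pairwiseSum M (λ s t → 𝟙 (does (cross? s t)))
crossings≡pairwiseSum []      = refl
crossings≡pairwiseSum (s ∷ M) = cong₂ _+_ (length-filter≡sum (cross? s) M) (crossings≡pairwiseSum M)

pairwiseSum-map : ∀ {a b} {A : Set a} {B : Set b} (g : A → B) (h : B → B → ℕ) xs →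
                  pairwiseSum (map g xs) h ≡ pairwiseSum xs (λ x y → h (g x) (g y))
pairwiseSum-map g h []       = refl
pairwiseSum-map g h (x ∷ xs) = cong₂ _+_ (cong sum (sym (map-∘ xs))) (pairwiseSum-map g h xs)

pairwiseSum-filter : ∀ {a p} {A : Set a} {P : Pred A p} (P? : Decidable P) (h : A → A → ℕ) xs →
  pairwiseSum (filter P? xs) h ≡ pairwiseSum xs (λ x y → 𝟙 (does (P? x)) * (𝟙 (does (P? y)) * h x y))
pairwiseSum-filter P? h [] = refl
pairwiseSum-filter P? h (x ∷ xs) with does (P? x)
... | true  = cong₂ _+_
  (trans (sum-map-filter P? (h x) xs) (cong sum (map-cong (λ y → sym (*-identityˡ _)) xs)))
  (pairwiseSum-filter P? h xs)
... | false = trans (pairwiseSum-filter P? h xs) (cong (λ m → m + pairwiseSum xs _) (sym (sum-map-zero xs)))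
  where
  sum-map-zero : ∀ (ys : List _) → sum (map (λ _ → 0) ys) ≡ 0
  sum-map-zero []       = refl
  sum-map-zero (_ ∷ ys) = sum-map-zero ys

pairwiseSum-tabulate : ∀ {a} {A : Set a} {n} (f : Fin n → A) (h : A → A → ℕ) →
  pairwiseSum (tabulate f) h ≡ ∑[ i < n ] ∑[ j < n ] (𝟙 (toℕ i <ᵇ toℕ j) * h (f i) (f j))
pairwiseSum-tabulate {n = zero}  f h = refl
pairwiseSum-tabulate {n = suc n} f h = cong₂ _+_
  (trans (sum-map-tabulate (h (f fzero)) (f ∘ fsuc)) (sum-cong-≗ {n} (λ j → sym (*-identityˡ _))))
  (pairwiseSum-tabulate (f ∘ fsuc) h)

count-interval : ∀ {n} a b → b ≤ n → ∑[ y < n ] 𝟙 ((toℕ y <ᵇ b) ∧ not (toℕ y <ᵇ a)) ≡ b ∸ a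
count-interval {zero}  a zero    z≤n     = sym (0∸n≡0 a)
count-interval {suc n} a zero    _       = trans (sum-replicate-zero (suc n)) (sym (0∸n≡0 a))
count-interval {suc n} zero    (suc b) (s≤s b≤n) = cong suc (count-interval zero b b≤n)
count-interval {suc n} (suc a) (suc b) (s≤s b≤n) = count-interval a b b≤n

<ᵇ-true : ∀ {m n} → m < n → (m <ᵇ n) ≡ true
<ᵇ-true (s≤s z≤n)       = refl
<ᵇ-true (s≤s (s≤s m<n)) = <ᵇ-true (s≤s m<n)

<ᵇ-false : ∀ {m n} → n ≤ m → (m <ᵇ n) ≡ false
<ᵇ-false z≤n       = refl
<ᵇ-false (s≤s n≤m) = <ᵇ-false n≤m

<ᵇ-cong-⇔ : ∀ {m n m′ n′} → (m < n → m′ < n′) → (m′ < n′ → m < n) → (m <ᵇ n) ≡ (m′ <ᵇ n′)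
<ᵇ-cong-⇔ {m} {n} to from with m <? n
... | yes m<n = trans (<ᵇ-true m<n) (sym (<ᵇ-true (to m<n)))
... | no  m≮n = trans (<ᵇ-false (≮⇒≥ m≮n)) (sym (<ᵇ-false (≮⇒≥ (m≮n ∘ from))))

_≐ᵇ_ : ℕ → ℕ → Bool
m ≐ᵇ n = not (m <ᵇ n) ∧ not (n <ᵇ m)

≐ᵇ-true : ∀ {m n} → m ≡ n → (m ≐ᵇ n) ≡ true
≐ᵇ-true {m} refl rewrite <ᵇ-false (≤-refl {m}) = refl

≐ᵇ-false : ∀ {m n} → m ≢ n → (m ≐ᵇ n) ≡ false
≐ᵇ-false {m} {n} m≢n with <-cmp m n
... | tri< m<n _   _   rewrite <ᵇ-true m<n = refl
... | tri≈ _   m≡n _   = contradiction m≡n m≢n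
... | tri> _   _   n<m rewrite <ᵇ-false (<⇒≤ n<m) | <ᵇ-true n<m = refl

≐ᵇ-cong-⇔ : ∀ {m n m′ n′} → (m ≡ n → m′ ≡ n′) → (m′ ≡ n′ → m ≡ n) → (m ≐ᵇ n) ≡ (m′ ≐ᵇ n′)
≐ᵇ-cong-⇔ {m} {n} to from with m ≟ n
... | yes m≡n = trans (≐ᵇ-true m≡n) (sym (≐ᵇ-true (to m≡n)))
... | no  m≢n = trans (≐ᵇ-false m≢n) (sym (≐ᵇ-false (m≢n ∘ from)))

count-equal : ∀ {n} m → m < n → ∑[ y < n ] 𝟙 (m ≐ᵇ toℕ y) ≡ 1
count-equal {suc n} zero    _         = cong suc (sum-replicate-zero n)
count-equal {suc n} (suc m) (s≤s m<n) = count-equal m m<n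

𝟙≤1 : ∀ b → 𝟙 b ≤ 1
𝟙≤1 true  = ≤-refl
𝟙≤1 false = z≤n

𝟙-<ᵇ-monoʳ : ∀ w {u v} → u ≤ v → 𝟙 (w <ᵇ u) ≤ 𝟙 (w <ᵇ v)
𝟙-<ᵇ-monoʳ w {u} u≤v with w <? u
... | yes w<u rewrite <ᵇ-true w<u | <ᵇ-true (<-≤-trans w<u u≤v) = ≤-refl
... | no  w≮u rewrite <ᵇ-false (≮⇒≥ w≮u) = z≤n

rank : ∀ {n} → Vec ℕ n → ℕ → ℕ
rank []ᵛ        u = 0
rank (w ∷ᵛ ws) u = 𝟙 (w <ᵇ u) + rank ws u

rank-mono : ∀ {n} (ws : Vec ℕ n) {u v} → u ≤ v → rank ws u ≤ rank ws v
rank-mono []ᵛ        u≤v = z≤n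
rank-mono (w ∷ᵛ ws) u≤v = +-mono-≤ (𝟙-<ᵇ-monoʳ w u≤v) (rank-mono ws u≤v)

rank-strict : ∀ {n} {ws : Vec ℕ n} {u v} → u ∈ ws → u < v → rank ws u < rank ws v
rank-strict {ws = u ∷ᵛ ws} (here refl) u<v rewrite <ᵇ-false (≤-refl {u}) | <ᵇ-true u<v =
  s≤s (rank-mono ws (<⇒≤ u<v))
rank-strict {ws = w ∷ᵛ ws} (there u∈ws) u<v =
  +-mono-≤-< (𝟙-<ᵇ-monoʳ w (<⇒≤ u<v)) (rank-strict u∈ws u<v)

rank-≤ : ∀ {n} (ws : Vec ℕ n) u → rank ws u ≤ n
rank-≤ []ᵛ        u = z≤n
rank-≤ (w ∷ᵛ ws) u = +-mono-≤ (𝟙≤1 (w <ᵇ u)) (rank-≤ ws u)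

rank-< : ∀ {n} {ws : Vec ℕ n} {u} → u ∈ ws → rank ws u < n
rank-< {ws = u ∷ᵛ ws} (here refl) rewrite <ᵇ-false (≤-refl {u}) = s≤s (rank-≤ ws u)
rank-< {ws = w ∷ᵛ ws} (there u∈ws) = +-mono-≤-< (𝟙≤1 _) (rank-< u∈ws)

rank-<ᵇ : ∀ {n} {ws : Vec ℕ n} {u} → u ∈ ws → ∀ v → (u <ᵇ v) ≡ (rank ws u <ᵇ rank ws v)
rank-<ᵇ {ws = ws} {u} u∈ws v = <ᵇ-cong-⇔ (rank-strict u∈ws) reflect
  where
  reflect : rank ws u < rank ws v → u < v
  reflect r< with u <? v
  ... | yes u<v = u<v
  ... | no  u≮v = contradiction (rank-mono ws (≮⇒≥ u≮v)) (<⇒≱ r<)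

Quad : Set
Quad = Vec ℕ 4

Comparisons : Set
Comparisons = Vec (Vec Bool 4) 4

orderType : Quad → Comparisons
orderType q = tabulateᵛ λ i → tabulateᵛ λ j → lookup q i <ᵇ lookup q j

record _≅_ (q r : Quad) : Set where
  constructor same-order
  field <ᵇ-≡ : ∀ i j → (lookup q i <ᵇ lookup q j) ≡ (lookup r i <ᵇ lookup r j)

orderType-cong : ∀ {q r} → q ≅ r → orderType q ≡ orderType r
orderType-cong (same-order q≅r) = tabulate-cong λ i → tabulate-cong λ j → q≅r i j

permute : (Fin 4 → Fin 4) → Quad → Quad
permute σ q = tabulateᵛ (lookup q ∘ σ)

permute-≅ : ∀ σ {q r} → q ≅ r → permute σ q ≅ permute σ r
permute-≅ σ {q} {r} (same-order q≅r) = same-order λ i j → begin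
  lookup (permute σ q) i <ᵇ lookup (permute σ q) j
    ≡⟨ cong₂ _<ᵇ_ (lookup∘tabulate (lookup q ∘ σ) i) (lookup∘tabulate (lookup q ∘ σ) j) ⟩
  lookup q (σ i) <ᵇ lookup q (σ j)
    ≡⟨ q≅r (σ i) (σ j) ⟩
  lookup r (σ i) <ᵇ lookup r (σ j)
    ≡⟨ cong₂ _<ᵇ_ (lookup∘tabulate (lookup r ∘ σ) i) (lookup∘tabulate (lookup r ∘ σ) j) ⟨
  lookup (permute σ r) i <ᵇ lookup (permute σ r) j ∎
  where open ≡-Reasoning

≅-ranks : ∀ q → q ≅ mapᵛ (rank q) q
≅-ranks q = same-order λ i j → trans (rank-<ᵇ (∈-lookup i q) (lookup q j))
  (sym (cong₂ _<ᵇ_ (lookup-map i (rank q) q) (lookup-map j (rank q) q)))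

X πX Y πY : Fin 4
X  = 0F
πX = 1F
Y  = 2F
πY = 3F

infix 7 _⊢_≺_ _⊢_≐_

_⊢_≺_ : Comparisons → Fin 4 → Fin 4 → Bool
t ⊢ i ≺ j = lookup (lookup t i) j

_⊢_≐_ : Comparisons → Fin 4 → Fin 4 → Bool
t ⊢ i ≐ j = not (t ⊢ i ≺ j) ∧ not (t ⊢ j ≺ i)

inversionᶜ twoCycleᶜ crossingᶜ lengthᶜ : Comparisons → ℕ
inversionᶜ t = 𝟙 (t ⊢ X ≺ Y ∧ t ⊢ πY ≺ πX)
-- The factor x ≐ y selects y = x, turning the count of two-cycles into a double sum.
twoCycleᶜ  t = 𝟙 (t ⊢ X ≺ πX) * 𝟙 (t ⊢ X ≐ Y)
crossingᶜ  t = 𝟙 (t ⊢ X ≺ Y) * (𝟙 (t ⊢ X ≺ πX) * (𝟙 (t ⊢ Y ≺ πY) * 𝟙 crosses))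
  where
  crosses = t ⊢ X ≺ Y ∧ t ⊢ Y ≺ πX ∧ t ⊢ πX ≺ πY ∨ t ⊢ Y ≺ X ∧ t ⊢ X ≺ πY ∧ t ⊢ πY ≺ πX
lengthᶜ    t = 𝟙 (t ⊢ X ≺ πX) * 𝟙 (t ⊢ Y ≺ πX ∧ not (t ⊢ Y ≺ X))

Consistent : Comparisons → Set
Consistent t = (t ⊢ X ≐ Y ≡ t ⊢ πX ≐ πY) × (t ⊢ X ≐ πY ≡ t ⊢ πX ≐ Y)

Weight : Set
Weight = Quad → ℕ

lhsᶜ rhsᶜ : Comparisons → ℕ
lhsᶜ t = inversionᶜ t + twoCycleᶜ t + 2 * crossingᶜ t
rhsᶜ t = 2 * lengthᶜ t

lhs rhs : Weight
lhs = lhsᶜ ∘ orderType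
rhs = rhsᶜ ∘ orderType

swapX swapY swapXY : Fin 4 → Fin 4
swapX 0F = 1F
swapX 1F = 0F
swapX i  = i
swapY 2F = 3F
swapY 3F = 2F
swapY i  = i
swapXY 0F = 2F
swapXY 1F = 3F
swapXY 2F = 0F
swapXY 3F = 1F

symmetrize : (Fin 4 → Fin 4) → Weight → Weight
symmetrize σ K q = K q + K (permute σ q)

orbit : Weight → Weight
orbit = symmetrize swapXY ∘ symmetrize swapY ∘ symmetrize swapX

OrderInvariant : Weight → Set
OrderInvariant K = ∀ {q r} → q ≅ r → K q ≡ K r

orderType-invariant : ∀ (f : Comparisons → ℕ) → OrderInvariant (f ∘ orderType)
orderType-invariant f q≅r = cong f (orderType-cong q≅r)

symmetrize-invariant : ∀ σ {K} → OrderInvariant K → OrderInvariant (symmetrize σ K)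
symmetrize-invariant σ K-inv q≅r = cong₂ _+_ (K-inv q≅r) (K-inv (permute-≅ σ q≅r))

orbit-invariant : ∀ {K} → OrderInvariant K → OrderInvariant (orbit K)
orbit-invariant =
  symmetrize-invariant swapXY ∘ symmetrize-invariant swapY ∘ symmetrize-invariant swapX

Balanced : Quad → Set
Balanced q = Consistent (orderType q) → orbit lhs q ≡ orbit rhs q

balanced? : Decidable Balanced
balanced? q = (t ⊢ X ≐ Y Bool.≟ t ⊢ πX ≐ πY ×-dec t ⊢ X ≐ πY Bool.≟ t ⊢ πX ≐ Y)
              →-dec (orbit lhs q ≟ orbit rhs q)
  where t = orderType q

balanced-resp-≅ : ∀ {q r} → q ≅ r → Balanced r → Balanced q
balanced-resp-≅ {q} {r} q≅r balanced consistent = begin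
  orbit lhs q ≡⟨ orbit-invariant (orderType-invariant lhsᶜ) q≅r ⟩
  orbit lhs r ≡⟨ balanced (subst Consistent (orderType-cong q≅r) consistent) ⟩
  orbit rhs r ≡⟨ orbit-invariant (orderType-invariant rhsᶜ) q≅r ⟨
  orbit rhs q ∎
  where open ≡-Reasoning

balanced-below-4 : ∀ {a} → a < 4 → ∀ {b} → b < 4 → ∀ {c} → c < 4 → ∀ {d} → d < 4 →
                   Balanced (a ∷ᵛ b ∷ᵛ c ∷ᵛ d ∷ᵛ []ᵛ)
balanced-below-4 = from-yes (allUpTo? (λ a → allUpTo? (λ b → allUpTo? (λ c → allUpTo? (λ d →
  balanced? (a ∷ᵛ b ∷ᵛ c ∷ᵛ d ∷ᵛ []ᵛ)) 4) 4) 4) 4)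

orbit-balanced : ∀ q → Balanced q
orbit-balanced q@(_ ∷ᵛ _ ∷ᵛ _ ∷ᵛ _ ∷ᵛ []ᵛ) = balanced-resp-≅ (≅-ranks q)
  (balanced-below-4 (rank-< (∈-lookup 0F q)) (rank-< (∈-lookup 1F q))
                    (rank-< (∈-lookup 2F q)) (rank-< (∈-lookup 3F q)))

module _ {n} (π : Fin n → Fin n) (π-involutive : IsInvolution π) where

  strand : Fin n → Strand
  strand x = toℕ x , toℕ (π x)

  opens? : Decidable (λ x → toℕ x < toℕ (π x))
  opens? x = toℕ x <? toℕ (π x)

  opens : Fin n → ℕ
  opens x = 𝟙 (does (opens? x))

  quad : Fin n → Fin n → Quad
  quad x y = toℕ x ∷ᵛ toℕ (π x) ∷ᵛ toℕ y ∷ᵛ toℕ (π y) ∷ᵛ []ᵛ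

  pairSum : Weight → ℕ
  pairSum K = ∑[ x < n ] ∑[ y < n ] K (quad x y)

  π-transpose : ∀ {x y} → π x ≡ y → x ≡ π y
  π-transpose {x} πx≡y = trans (sym (π-involutive x)) (cong π πx≡y)

  quad-consistent : ∀ x y → Consistent (orderType (quad x y))
  quad-consistent x y =
    ≐ᵇ-cong-⇔ (λ x≡y → cong (toℕ ∘ π) (toℕ-injective x≡y))
              (λ πx≡πy → cong toℕ (trans (π-transpose (toℕ-injective πx≡πy)) (π-involutive y))) ,
    ≐ᵇ-cong-⇔ (λ x≡πy → cong toℕ (sym (π-transpose (sym (toℕ-injective x≡πy)))))
              (λ πx≡y → cong toℕ (π-transpose (toℕ-injective πx≡y)))

  ∑-reindex : ∀ (f : Fin n → ℕ) → ∑[ x < n ] f (π x) ≡ ∑[ x < n ] f x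
  ∑-reindex f = sym (∑-permute f (permutation π π π-involutive π-involutive))

  quad-swapX : ∀ x y → permute swapX (quad x y) ≡ quad (π x) y
  quad-swapX x y = cong (λ z → toℕ (π x) ∷ᵛ toℕ z ∷ᵛ _) (sym (π-involutive x))

  quad-swapY : ∀ x y → permute swapY (quad x y) ≡ quad x (π y)
  quad-swapY x y = cong (λ z → _ ∷ᵛ _ ∷ᵛ toℕ (π y) ∷ᵛ toℕ z ∷ᵛ []ᵛ) (sym (π-involutive y))

  Symmetry : (Fin 4 → Fin 4) → Set
  Symmetry σ = ∀ K → pairSum (K ∘ permute σ) ≡ pairSum K

  swapX-symmetry : Symmetry swapX
  swapX-symmetry K = trans (sum-cong-≗ λ x → sum-cong-≗ λ y → cong K (quad-swapX x y))
                           (∑-reindex λ x → ∑[ y < n ] K (quad x y))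

  swapY-symmetry : Symmetry swapY
  swapY-symmetry K = sum-cong-≗ λ x →
    trans (sum-cong-≗ λ y → cong K (quad-swapY x y)) (∑-reindex λ y → K (quad x y))

  swapXY-symmetry : Symmetry swapXY
  swapXY-symmetry K = ∑-comm λ y x → K (quad x y)

  pairSum-+ : ∀ K L → pairSum (λ q → K q + L q) ≡ pairSum K + pairSum L
  pairSum-+ K L = trans (sum-cong-≗ λ x → ∑-distrib-+ (λ y → K (quad x y)) (λ y → L (quad x y)))
                      (∑-distrib-+ (λ x → ∑[ y < n ] K (quad x y)) (λ x → ∑[ y < n ] L (quad x y)))

  pairSum-* : ∀ k K → pairSum (λ q → k * K q) ≡ k * pairSum K
  pairSum-* k K = sym (trans (*-distribˡ-sum k (λ x → ∑[ y < n ] K (quad x y)))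
                            (sum-cong-≗ λ x → *-distribˡ-sum k (λ y → K (quad x y))))

  pairSum-symmetrize : ∀ σ → Symmetry σ → ∀ K → pairSum (symmetrize σ K) ≡ 2 * pairSum K
  pairSum-symmetrize σ σ-symmetry K = begin
    pairSum (symmetrize σ K)            ≡⟨ pairSum-+ K (K ∘ permute σ) ⟩
    pairSum K + pairSum (K ∘ permute σ) ≡⟨ cong (_+_ (pairSum K)) (σ-symmetry K) ⟩
    pairSum K + pairSum K               ≡⟨ cong (_+_ (pairSum K)) (+-identityʳ (pairSum K)) ⟨
    2 * pairSum K                       ∎
    where open ≡-Reasoning

  pairSum-orbit : ∀ K → pairSum (orbit K) ≡ 8 * pairSum K
  pairSum-orbit K = begin
    pairSum (orbit K)         ≡⟨ pairSum-symmetrize swapXY swapXY-symmetry K₂ ⟩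
    2 * pairSum K₂            ≡⟨ cong (2 *_) (pairSum-symmetrize swapY swapY-symmetry K₁) ⟩
    2 * (2 * pairSum K₁)      ≡⟨ cong (λ m → 2 * (2 * m)) (pairSum-symmetrize swapX swapX-symmetry K) ⟩
    2 * (2 * (2 * pairSum K)) ≡⟨ *-assoc 2 2 (2 * pairSum K) ⟨
    4 * (2 * pairSum K)       ≡⟨ *-assoc 4 2 (pairSum K) ⟨
    8 * pairSum K             ∎
    where
    open ≡-Reasoning
    K₁ K₂ : Weight
    K₁ = symmetrize swapX K
    K₂ = symmetrize swapY K₁

  pairSum-lhs≡rhs : pairSum lhs ≡ pairSum rhs
  pairSum-lhs≡rhs = *-cancelˡ-≡ _ _ 8 (begin
    8 * pairSum lhs     ≡⟨ pairSum-orbit lhs ⟨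
    pairSum (orbit lhs) ≡⟨ sum-cong-≗ (λ x → sum-cong-≗ λ y →
                             orbit-balanced (quad x y) (quad-consistent x y)) ⟩
    pairSum (orbit rhs) ≡⟨ pairSum-orbit rhs ⟩
    8 * pairSum rhs     ∎)
    where open ≡-Reasoning

  inversions≡pairSum : inversions π ≡ pairSum (inversionᶜ ∘ orderType)
  inversions≡pairSum = begin
    inversions π
      ≡⟨ length-filter≡sum _ (cartesianProduct (allFin n) (allFin n)) ⟩
    sum (map inverted (cartesianProduct (allFin n) (allFin n)))
      ≡⟨ sum-map-cartesianProduct inverted (allFin n) (allFin n) ⟩
    sum (map (λ x → sum (map (λ y → inverted (x , y)) (allFin n))) (allFin n))
      ≡⟨ sum-map-allFin (λ x → sum (map (λ y → inverted (x , y)) (allFin n))) ⟩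
    ∑[ x < n ] sum (map (λ y → inverted (x , y)) (allFin n))
      ≡⟨ sum-cong-≗ (λ x → sum-map-allFin (λ y → inverted (x , y))) ⟩
    pairSum (inversionᶜ ∘ orderType) ∎
    where
    open ≡-Reasoning
    inverted : Fin n × Fin n → ℕ
    inverted (x , y) = 𝟙 ((toℕ x <ᵇ toℕ y) ∧ (toℕ (π y) <ᵇ toℕ (π x)))

  twoCycles≡pairSum : twoCycles π ≡ pairSum (twoCycleᶜ ∘ orderType)
  twoCycles≡pairSum = begin
    twoCycles π
      ≡⟨ length-filter≡sum opens? (allFin n) ⟩
    sum (map opens (allFin n))
      ≡⟨ sum-map-allFin opens ⟩
    ∑[ x < n ] opens x
      ≡⟨ sum-cong-≗ {n} (λ x → *-identityʳ (opens x)) ⟨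
    ∑[ x < n ] (opens x * 1)
      ≡⟨ sum-cong-≗ (λ x → cong (opens x *_) (count-equal (toℕ x) (toℕ<n x))) ⟨
    ∑[ x < n ] (opens x * ∑[ y < n ] 𝟙 (toℕ x ≐ᵇ toℕ y))
      ≡⟨ sum-cong-≗ (λ x → *-distribˡ-sum {n} (opens x) (λ y → 𝟙 (toℕ x ≐ᵇ toℕ y))) ⟩
    pairSum (twoCycleᶜ ∘ orderType) ∎
    where open ≡-Reasoning

  crossings≡pairSum : crossings (matchingOf π) ≡ pairSum (crossingᶜ ∘ orderType)
  crossings≡pairSum = begin
    crossings (map strand (filter opens? (allFin n)))
      ≡⟨ crossings≡pairwiseSum (map strand (filter opens? (allFin n))) ⟩
    pairwiseSum (map strand (filter opens? (allFin n))) crossing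
      ≡⟨ pairwiseSum-map strand crossing (filter opens? (allFin n)) ⟩
    pairwiseSum (filter opens? (allFin n)) strandsCross
      ≡⟨ pairwiseSum-filter opens? strandsCross (allFin n) ⟩
    pairwiseSum (allFin n) (λ x y → opens x * (opens y * strandsCross x y))
      ≡⟨ pairwiseSum-tabulate (λ x → x) (λ x y → opens x * (opens y * strandsCross x y)) ⟩
    pairSum (crossingᶜ ∘ orderType) ∎
    where
    open ≡-Reasoning
    crossing : Strand → Strand → ℕ
    crossing s t = 𝟙 (does (cross? s t))
    strandsCross : Fin n → Fin n → ℕ
    strandsCross x y = crossing (strand x) (strand y)

  strandLengths≡pairSum : sum (map strandLength (matchingOf π)) ≡ pairSum (lengthᶜ ∘ orderType)
  strandLengths≡pairSum = begin
    sum (map strandLength (map strand (filter opens? (allFin n))))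
      ≡⟨ cong sum (map-∘ (filter opens? (allFin n))) ⟨
    sum (map (strandLength ∘ strand) (filter opens? (allFin n)))
      ≡⟨ sum-map-filter opens? (strandLength ∘ strand) (allFin n) ⟩
    sum (map (λ x → opens x * (toℕ (π x) ∸ toℕ x)) (allFin n))
      ≡⟨ sum-map-allFin (λ x → opens x * (toℕ (π x) ∸ toℕ x)) ⟩
    ∑[ x < n ] (opens x * (toℕ (π x) ∸ toℕ x))
      ≡⟨ sum-cong-≗ (λ x → cong (opens x *_)
           (count-interval (toℕ x) (toℕ (π x)) (<⇒≤ (toℕ<n (π x))))) ⟨
    ∑[ x < n ] (opens x * ∑[ y < n ] 𝟙 ((toℕ y <ᵇ toℕ (π x)) ∧ not (toℕ y <ᵇ toℕ x)))
      ≡⟨ sum-cong-≗ (λ x → *-distribˡ-sum {n} (opens x) λ y →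
           𝟙 ((toℕ y <ᵇ toℕ (π x)) ∧ not (toℕ y <ᵇ toℕ x))) ⟩
    pairSum (lengthᶜ ∘ orderType) ∎
    where open ≡-Reasoning

  double-counting : inversions π + twoCycles π + 2 * crossings (matchingOf π) ≡
                    2 * sum (map strandLength (matchingOf π))
  double-counting = begin
    inversions π + twoCycles π + 2 * crossings (matchingOf π)
      ≡⟨ cong₂ _+_ (cong₂ _+_ inversions≡pairSum twoCycles≡pairSum) (cong (2 *_) crossings≡pairSum) ⟩
    pairSum inversion + pairSum twoCycle + 2 * pairSum crossing
      ≡⟨ cong₂ _+_ (pairSum-+ inversion twoCycle) (pairSum-* 2 crossing) ⟨
    pairSum (λ q → inversion q + twoCycle q) + pairSum (λ q → 2 * crossing q)
      ≡⟨ pairSum-+ (λ q → inversion q + twoCycle q) (λ q → 2 * crossing q) ⟨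
    pairSum lhs
      ≡⟨ pairSum-lhs≡rhs ⟩
    pairSum rhs
      ≡⟨ pairSum-* 2 (lengthᶜ ∘ orderType) ⟩
    2 * pairSum (lengthᶜ ∘ orderType)
      ≡⟨ cong (2 *_) strandLengths≡pairSum ⟨
    2 * sum (map strandLength (matchingOf π)) ∎
    where
    open ≡-Reasoning
    inversion twoCycle crossing : Weight
    inversion = inversionᶜ ∘ orderType
    twoCycle  = twoCycleᶜ ∘ orderType
    crossing  = crossingᶜ ∘ orderType

half-difference : ∀ i c l → i + 2 * c ≡ 2 * l → + (i / 2) ≡ + l ℤ.- + c
half-difference i c l i+2c≡2l = begin
  + (i / 2)           ≡⟨ cong (λ m → + (m / 2)) i≡[l∸c]*2 ⟩
  + ((l ∸ c) * 2 / 2) ≡⟨ cong +_ (m*n/n≡m (l ∸ c) 2) ⟩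
  + (l ∸ c)           ≡⟨ ℤ.⊖-≥ c≤l ⟨
  l ℤ.⊖ c             ≡⟨ ℤ.m-n≡m⊖n l c ⟨
  + l ℤ.- + c         ∎
  where
  open ≡-Reasoning
  c≤l : c ≤ l
  c≤l = *-cancelˡ-≤ 2 (subst (2 * c ≤_) i+2c≡2l (m≤n+m (2 * c) i))
  i≡[l∸c]*2 : i ≡ (l ∸ c) * 2
  i≡[l∸c]*2 = begin
    i                 ≡⟨ m+n∸n≡m i (2 * c) ⟨
    i + 2 * c ∸ 2 * c ≡⟨ cong (_∸ 2 * c) i+2c≡2l ⟩
    2 * l ∸ 2 * c     ≡⟨ *-distribˡ-∸ 2 l c ⟨
    2 * (l ∸ c)       ≡⟨ *-comm 2 (l ∸ c) ⟩
    (l ∸ c) * 2       ∎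

lemma2p6 : (n : ℕ) (π : Fin n → Fin n) → IsInvolution π →
    + Linv π ≡ Lmatch (matchingOf π)
lemma2p6 _ π π-involutive =
  half-difference (inversions π + twoCycles π) (crossings (matchingOf π))
                  (sum (map strandLength (matchingOf π))) (double-counting π π-involutive)
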